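{- Let $A\subseteq\omega$ be $m$-rigid and let $S,T\subseteq\omega$ be computable sets such that $T\setminus S$ is infinite. For a computable set $U$ let $D_U=\{\langle x,i\rangle : x\in U\text{ or } i=0\}$, fix a computable bijection $\sigma_U:\omega\to D_U$, and let $B_U=\{n\in\omega:\pi_1(\sigma_U(n))\in A\}$. Then $B_T\not\le_{fin}B_S$.
   Context: $\langle\cdot,\cdot\rangle$ is a standard computable pairing function on $\omega$ with computable projections $\pi_1,\pi_2$. A set $A$ is $m$-rigid if for every total computable $f$ with $x\in A\iff f(x)\in A$ for all $x$, $f(x)=x$ for all but finitely many $x$. $X\le_{fin}Y$ means there is a total computable finite-to-one $f$ (i.e. $|f^{ -1}(y)|<\infty$ for all $y$) with $x\in X\iff f(x)\in Y$ for all $x$. -}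

module Defs where

open import Data.Nat using (ℕ; zero; suc; _+_; _≤_; _<_)
open import Data.Fin using (Fin)
open import Data.Vec using (Vec; []; _∷_; lookup)
open import Data.Product using (Σ; ∃; _×_; _,_; proj₁)
open import Data.Sum using (_⊎_)
open import Relation.Nullary using (¬_)
open import Relation.Binary.PropositionalEquality using (_≡_)

data PRec : ℕ → Set where
  zer  : ∀ {n} → PRec n
  succ : PRec 1
  proj : ∀ {n} → Fin n → PRec n
  comp : ∀ {m n} → PRec m → Vec (PRec n) m → PRec n
  prec : ∀ {n} → PRec n → PRec (suc (suc n)) → PRec (suc n)
  mu   : ∀ {n} → PRec (suc n) → PRec n

mutual
  data Eval : ∀ {n} → PRec n → Vec ℕ n → ℕ → Set where
    e-zer  : ∀ {n} {xs : Vec ℕ n} → Eval zer xs 0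
    e-succ : ∀ {x} → Eval succ (x ∷ []) (suc x)
    e-proj : ∀ {n} {i : Fin n} {xs} → Eval (proj i) xs (lookup xs i)
    e-comp : ∀ {m n} {f : PRec m} {gs : Vec (PRec n) m} {xs ys y} →
             EvalVec gs xs ys → Eval f ys y → Eval (comp f gs) xs y
    e-prec0 : ∀ {n} {g : PRec n} {h} {xs y} →
              Eval g xs y → Eval (prec g h) (0 ∷ xs) y
    e-precS : ∀ {n} {g : PRec n} {h} {k xs r y} →
              Eval (prec g h) (k ∷ xs) r → Eval h (k ∷ r ∷ xs) y →
              Eval (prec g h) (suc k ∷ xs) y
    e-mu   : ∀ {n} {f : PRec (suc n)} {xs y} →
             MuSearch f xs 0 y → Eval (mu f) xs y

  data EvalVec : ∀ {m n} → Vec (PRec n) m → Vec ℕ n → Vec ℕ m → Set where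
    ev-[] : ∀ {n} {xs : Vec ℕ n} → EvalVec [] xs []
    ev-∷  : ∀ {m n} {g : PRec n} {gs : Vec (PRec n) m} {xs y ys} →
            Eval g xs y → EvalVec gs xs ys → EvalVec (g ∷ gs) xs (y ∷ ys)

  -- MuSearch f xs k y : least y ≥ k with f(y,xs)=0, all f(z,xs) for
  -- k ≤ z < y defined and nonzero
  data MuSearch : ∀ {n} → PRec (suc n) → Vec ℕ n → ℕ → ℕ → Set where
    ms-here : ∀ {n} {f : PRec (suc n)} {xs k} →
              Eval f (k ∷ xs) 0 → MuSearch f xs k k
    ms-next : ∀ {n} {f : PRec (suc n)} {xs k w y} →
              Eval f (k ∷ xs) (suc w) → MuSearch f xs (suc k) y →
              MuSearch f xs k y

Computable : (ℕ → ℕ) → Set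
Computable f = Σ (PRec 1) λ c → ∀ x → Eval c (x ∷ []) (f x)

SetN : Set₁
SetN = ℕ → Set

_⇔_ : Set → Set → Set
P ⇔ Q = (P → Q) × (Q → P)

ComputableSet : SetN → Set
ComputableSet S = Σ (ℕ → ℕ) λ χ → Computable χ × (∀ x → S x ⇔ (χ x ≡ 0))

Infinite : SetN → Set
Infinite X = ∀ N → ∃ λ x → N ≤ x × X x

-- Cantor pairing ⟨x,i⟩ and projections

tri : ℕ → ℕ
tri zero = zero
tri (suc k) = suc k + tri k

pair : ℕ → ℕ → ℕ
pair x y = tri (x + y) + y

unpairStep : ℕ × ℕ → ℕ × ℕ
unpairStep (suc x , y) = (x , suc y)
unpairStep (zero , y) = (suc y , zero)

unpair : ℕ → ℕ × ℕ
unpair zero = (zero , zero)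
unpair (suc n) = unpairStep (unpair n)

π₁ : ℕ → ℕ
π₁ n = proj₁ (unpair n)

MRigid : SetN → Set
MRigid A = ∀ (f : ℕ → ℕ) → Computable f → (∀ x → A x ⇔ A (f x)) →
           ∃ λ N → ∀ x → N ≤ x → f x ≡ x

FiniteToOne : (ℕ → ℕ) → Set
FiniteToOne f = ∀ y → ∃ λ N → ∀ x → f x ≡ y → x < N

_≤fin_ : SetN → SetN → Set
X ≤fin Y = Σ (ℕ → ℕ) λ f → Computable f × FiniteToOne f × (∀ x → X x ⇔ Y (f x))

D : SetN → SetN
D U n = ∃ λ x → ∃ λ i → n ≡ pair x i × (U x ⊎ i ≡ 0)

CompBijOnto : (ℕ → ℕ) → SetN → Set
CompBijOnto σ X = Computable σ × (∀ n → X (σ n))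
                × (∀ m n → σ m ≡ σ n → m ≡ n)
                × (∀ y → X y → ∃ λ n → σ n ≡ y)

B : SetN → (ℕ → ℕ) → SetN
B A σ n = A (π₁ (σ n))

_∖_ : SetN → SetN → SetN
(T ∖ S) x = T x × ¬ S x

{-# OPTIONS --safe #-}
-- Let f reduce B_T to B_S. Over every x the point ⟨x,0⟩ lies in D_T, and over x ∈ T so does
-- the whole column ⟨x,i⟩. For x ∉ S the only point of D_S over x is ⟨x,0⟩, and f, being
-- finite-to-one, cannot send all σT-preimages of the column to its σS-preimage. So an
-- unbounded search finds, for every x, some n with π₁ (σT n) = x that f moves off the fibre
-- over x whenever x ∈ T∖S. Then h x = π₁ (σS (f n)) is a computable self-reduction of A
-- with h x ≠ x on the infinite set T∖S, which m-rigidity forbids.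
module Submission where

open import Defs
open import Relation.Nullary using (¬_; Dec; yes; no)
open import Relation.Nullary.Decidable using (map′)
open import Relation.Binary.PropositionalEquality
  using (_≡_; _≢_; _≗_; refl; sym; trans; cong; cong₂; subst; module ≡-Reasoning)
open import Data.Nat using (ℕ; zero; suc; _+_; _*_; _∸_; _≤_; _<_; _≟_; _≤?_; z≤n; s≤s; pred)
open import Data.Nat.Properties
open import Data.Fin using (Fin; toℕ; fromℕ<; #_)
open import Data.Fin.Properties using (any?; pigeonhole; fromℕ<-injective)
open import Data.Vec using ([]; _∷_)
open import Data.Product using (Σ; ∃; _×_; _,_; proj₁; proj₂; uncurry)
open import Data.Sum using (_⊎_; inj₁; inj₂)
open import Data.Empty using (⊥-elim)
open import Function using (_∘_; id; const)
open import Function.Definitions using (Injective)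

private
  variable
    f g : ℕ → ℕ
    op f₂ g₂ : ℕ → ℕ → ℕ
    P Q : ℕ → ℕ → Set
    U : SetN

Computable₂ : (ℕ → ℕ → ℕ) → Set
Computable₂ g = Σ (PRec 2) λ c → ∀ a b → Eval c (a ∷ b ∷ []) (g a b)

computable-ext : f ≗ g → Computable f → Computable g
computable-ext f≗g (c , eval) = c , λ x → subst (Eval c (x ∷ [])) (f≗g x) (eval x)

id-computable : Computable id
id-computable = proj (# 0) , λ _ → e-proj

suc-computable : Computable suc
suc-computable = succ , λ _ → e-succ

∘-computable : Computable f → Computable g → Computable (f ∘ g)
∘-computable {f} {g} (cf , ef) (cg , eg) =
  comp cf (cg ∷ []) , λ x → e-comp (ev-∷ (eg x) ev-[]) (ef (g x))

∘₂-computable : Computable₂ op → Computable f → Computable g → Computable (λ x → op (f x) (g x))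
∘₂-computable {op} {f} {g} (c , e) (cf , ef) (cg , eg) =
  comp c (cf ∷ cg ∷ []) , λ x → e-comp (ev-∷ (ef x) (ev-∷ (eg x) ev-[])) (e (f x) (g x))

∘-computable₂ : Computable f → Computable₂ g₂ → Computable₂ (λ a b → f (g₂ a b))
∘-computable₂ {f} {g₂} (cf , ef) (cg , eg) =
  comp cf (cg ∷ []) , λ a b → e-comp (ev-∷ (eg a b) ev-[]) (ef (g₂ a b))

∘₂-computable₂ : Computable₂ op → Computable₂ f₂ → Computable₂ g₂ →
                 Computable₂ (λ a b → op (f₂ a b) (g₂ a b))
∘₂-computable₂ {op} {f₂} {g₂} (c , e) (cf , ef) (cg , eg) =
  comp c (cf ∷ cg ∷ []) ,
  λ a b → e-comp (ev-∷ (ef a b) (ev-∷ (eg a b) ev-[])) (e (f₂ a b) (g₂ a b))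

const-computable : ∀ k → Computable (const k)
const-computable zero    = zer , λ _ → e-zer
const-computable (suc k) = ∘-computable suc-computable (const-computable k)

first-computable₂ : Computable₂ (λ a _ → a)
first-computable₂ = proj (# 0) , λ _ _ → e-proj

second-computable₂ : Computable₂ (λ _ b → b)
second-computable₂ = proj (# 1) , λ _ _ → e-proj

left-computable₂ : Computable f → Computable₂ (λ a _ → f a)
left-computable₂ f? = ∘-computable₂ f? first-computable₂

right-computable₂ : Computable f → Computable₂ (λ _ b → f b)
right-computable₂ f? = ∘-computable₂ f? second-computable₂

+-computable₂ : Computable₂ _+_
+-computable₂ = code , eval
  where
  code : PRec 2
  code = prec (proj (# 0)) (comp succ (proj (# 1) ∷ []))
  eval : ∀ a b → Eval code (a ∷ b ∷ []) (a + b)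
  eval zero    b = e-prec0 e-proj
  eval (suc a) b = e-precS (eval a b) (e-comp (ev-∷ e-proj ev-[]) e-succ)

*-computable₂ : Computable₂ _*_
*-computable₂ = code , eval
  where
  code : PRec 2
  code = prec zer (comp (proj₁ +-computable₂) (proj (# 2) ∷ proj (# 1) ∷ []))
  eval : ∀ a b → Eval code (a ∷ b ∷ []) (a * b)
  eval zero    b = e-prec0 e-zer
  eval (suc a) b = e-precS (eval a b)
    (e-comp (ev-∷ e-proj (ev-∷ e-proj ev-[])) (proj₂ +-computable₂ b (a * b)))

pred-computable : Computable pred
pred-computable = code , eval
  where
  code : PRec 1
  code = prec zer (proj (# 0))
  eval : ∀ n → Eval code (n ∷ []) (pred n)
  eval zero    = e-prec0 e-zer
  eval (suc n) = e-precS (eval n) e-proj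

∸-computable₂ : Computable₂ _∸_
∸-computable₂ = ∘₂-computable₂ (code , eval) second-computable₂ first-computable₂
  where
  code : PRec 2
  code = prec (proj (# 0)) (comp (proj₁ pred-computable) (proj (# 1) ∷ []))
  eval : ∀ b a → Eval code (b ∷ a ∷ []) (a ∸ b)
  eval zero    a = e-prec0 e-proj
  eval (suc b) a = subst (Eval code (suc b ∷ a ∷ [])) (pred[m∸n]≡m∸[1+n] a b)
    (e-precS (eval b a) (e-comp (ev-∷ e-proj ev-[]) (proj₂ pred-computable (a ∸ b))))

1∸-computable : Computable (1 ∸_)
1∸-computable = ∘₂-computable ∸-computable₂ (const-computable 1) id-computable

tri-computable : Computable tri
tri-computable = code , eval
  where
  step : Computable₂ (λ k r → suc k + r)
  step = ∘₂-computable₂ +-computable₂ (left-computable₂ suc-computable) second-computable₂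
  code : PRec 1
  code = prec zer (proj₁ step)
  eval : ∀ k → Eval code (k ∷ []) (tri k)
  eval zero    = e-prec0 e-zer
  eval (suc k) = e-precS (eval k) (proj₂ step k (tri k))

IsLeastZero : (ℕ → ℕ) → ℕ → Set
IsLeastZero p m = p m ≡ 0 × (∀ j → j < m → p j ≢ 0)

least-zero : ∀ (p : ℕ → ℕ) {n} → p n ≡ 0 → ∃ (IsLeastZero p)
least-zero p {zero}  p0≡0 = 0 , p0≡0 , λ _ ()
least-zero p {suc n} pn≡0 with p 0 ≟ 0
... | yes p0≡0 = 0 , p0≡0 , λ _ ()
... | no  p0≢0 with m , pm≡0 , below ← least-zero (p ∘ suc) pn≡0 =
  suc m , pm≡0 , λ { zero _ → p0≢0 ; (suc j) (s≤s j<m) → below j j<m }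

mu-evaluates-to-least-zero : ∀ {n} {c : PRec (suc n)} {xs p m} →
                             (∀ j → Eval c (j ∷ xs) (p j)) → IsLeastZero p m → Eval (mu c) xs m
mu-evaluates-to-least-zero {c = c} {xs} {p} {m} eval (pm≡0 , below) =
  e-mu (search-from m 0 (+-identityʳ m))
  where
  search-from : ∀ d k → d + k ≡ m → MuSearch c xs k m
  search-from zero    k refl = ms-here (subst (Eval c (k ∷ xs)) pm≡0 (eval k))
  search-from (suc d) k d+k≡m with p k | eval k | below k (subst (k <_) d+k≡m (s≤s (m≤n+m k d)))
  ... | zero  | _      | pk≢0 = ⊥-elim (pk≢0 refl)
  ... | suc _ | eval-k | _    = ms-next eval-k (search-from d (suc k) (trans (+-suc d k) d+k≡m))

μ-computable : ∀ {χ : ℕ → ℕ → ℕ} {μ : ℕ → ℕ} →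
               Computable₂ χ → (∀ x → IsLeastZero (λ n → χ n x) (μ x)) → Computable μ
μ-computable (c , eval) least = mu c , λ x → mu-evaluates-to-least-zero (λ j → eval j x) (least x)

π₂ : ℕ → ℕ
π₂ n = proj₂ (unpair n)

pair-suc : ∀ a b → pair a (suc b) ≡ suc (pair (suc a) b)
pair-suc a b = trans (cong (λ s → tri s + suc b) (+-suc a b)) (+-suc (tri (suc (a + b))) b)

pair-suc-zero : ∀ a → pair (suc a) 0 ≡ suc (pair 0 a)
pair-suc-zero a = begin
  tri (suc a + 0) + 0  ≡⟨ +-identityʳ _ ⟩
  tri (suc a + 0)      ≡⟨ cong (tri ∘ suc) (+-identityʳ a) ⟩
  suc (a + tri a)      ≡⟨ cong suc (+-comm a (tri a)) ⟩
  suc (tri a + a)      ∎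
  where open ≡-Reasoning

pair-unpairStep : ∀ p → uncurry pair (unpairStep p) ≡ suc (uncurry pair p)
pair-unpairStep (suc a , b) = pair-suc a b
pair-unpairStep (zero  , b) = pair-suc-zero b

pair-unpair : uncurry pair ∘ unpair ≗ id
pair-unpair zero    = refl
pair-unpair (suc n) = trans (pair-unpairStep (unpair n)) (cong suc (pair-unpair n))

unpair-pair : ∀ {n} a b → pair a b ≡ n → unpair n ≡ (a , b)
unpair-pair zero zero refl = refl
unpair-pair {zero}  a (suc b) eq = ⊥-elim (1+n≢0 (trans (sym (pair-suc a b)) eq))
unpair-pair {suc n} a (suc b) eq =
  cong unpairStep (unpair-pair (suc a) b (suc-injective (trans (sym (pair-suc a b)) eq)))
unpair-pair {zero}  (suc a) zero eq = ⊥-elim (1+n≢0 (trans (sym (pair-suc-zero a)) eq))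
unpair-pair {suc n} (suc a) zero eq =
  cong unpairStep (unpair-pair zero a (suc-injective (trans (sym (pair-suc-zero a)) eq)))

π₁-pair : ∀ a b → π₁ (pair a b) ≡ a
π₁-pair a b = cong proj₁ (unpair-pair a b refl)

pair-injectiveʳ : ∀ a {b c} → pair a b ≡ pair a c → b ≡ c
pair-injectiveʳ a {b} {c} eq =
  cong proj₂ (trans (sym (unpair-pair a b refl)) (unpair-pair a c (sym eq)))

tri-mono-≤ : ∀ {j k} → j ≤ k → tri j ≤ tri k
tri-mono-≤ z≤n       = z≤n
tri-mono-≤ (s≤s j≤k) = +-mono-≤ (s≤s j≤k) (tri-mono-≤ j≤k)

diagonal : ℕ → ℕ
diagonal n = π₁ n + π₂ n

pair-diagonal-least : ∀ a b → IsLeastZero (λ s → suc (pair a b) ∸ tri (suc s)) (a + b)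
pair-diagonal-least a b = m≤n⇒m∸n≡0 (s≤s pair≤) , λ j j<a+b →
  m>n⇒m∸n≢0 (s≤s (≤-trans (tri-mono-≤ j<a+b) (m≤m+n (tri (a + b)) b)))
  where
  pair≤ : tri (a + b) + b ≤ a + b + tri (a + b)
  pair≤ = subst (tri (a + b) + b ≤_) (+-comm (tri (a + b)) (a + b))
                (+-monoʳ-≤ (tri (a + b)) (m≤n+m b a))

diagonal-least : ∀ n → IsLeastZero (λ s → suc n ∸ tri (suc s)) (diagonal n)
diagonal-least n = subst (λ m → IsLeastZero (λ s → suc m ∸ tri (suc s)) (diagonal n))
                         (pair-unpair n) (pair-diagonal-least (π₁ n) (π₂ n))

π₁-via-diagonal : ∀ n → diagonal n ∸ (n ∸ tri (diagonal n)) ≡ π₁ n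
π₁-via-diagonal n =
  subst (λ m → diagonal n ∸ (m ∸ tri (diagonal n)) ≡ π₁ n) (pair-unpair n) pair-case
  where
  a = π₁ n
  b = π₂ n
  pair-case : a + b ∸ (pair a b ∸ tri (a + b)) ≡ a
  pair-case = trans (cong (a + b ∸_) (m+n∸m≡n (tri (a + b)) b)) (m+n∸n≡m a b)

π₁-computable : Computable π₁
π₁-computable = computable-ext π₁-via-diagonal
  (∘₂-computable ∸-computable₂ diagonal-computable
    (∘₂-computable ∸-computable₂ id-computable (∘-computable tri-computable diagonal-computable)))
  where
  diagonal-computable : Computable diagonal
  diagonal-computable = μ-computable
    (∘₂-computable₂ ∸-computable₂ (right-computable₂ suc-computable)
                                   (left-computable₂ (∘-computable tri-computable suc-computable)))
    diagonal-least

ComputableRel : (ℕ → ℕ → Set) → Set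
ComputableRel R = Σ (ℕ → ℕ → ℕ) λ χ → Computable₂ χ × (∀ a b → R a b ⇔ (χ a b ≡ 0))

computableSet-dec : ComputableSet U → ∀ x → Dec (U x)
computableSet-dec (χ , _ , U⇔) x = map′ (proj₂ (U⇔ x)) (proj₁ (U⇔ x)) (χ x ≟ 0)

right-computableRel : ComputableSet U → ComputableRel (λ _ x → U x)
right-computableRel (χ , χ? , U⇔) = (λ _ x → χ x) , right-computable₂ χ? , λ _ → U⇔

≡-computableRel : Computable₂ f₂ → Computable₂ g₂ → ComputableRel (λ a b → f₂ a b ≡ g₂ a b)
≡-computableRel {f₂} {g₂} f? g? =
  (λ a b → (f₂ a b ∸ g₂ a b) + (g₂ a b ∸ f₂ a b)) ,
  ∘₂-computable₂ +-computable₂ (∘₂-computable₂ ∸-computable₂ f? g?)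
                               (∘₂-computable₂ ∸-computable₂ g? f?) ,
  λ a b → (λ eq → cong₂ _+_ (m≤n⇒m∸n≡0 (≤-reflexive eq)) (m≤n⇒m∸n≡0 (≤-reflexive (sym eq)))) ,
          (λ d≡0 → ≤-antisym (m∸n≡0⇒m≤n (m+n≡0⇒m≡0 _ d≡0)) (m∸n≡0⇒m≤n (m+n≡0⇒n≡0 _ d≡0)))

×-computableRel : ComputableRel P → ComputableRel Q → ComputableRel (λ a b → P a b × Q a b)
×-computableRel (χP , χP? , P⇔) (χQ , χQ? , Q⇔) =
  (λ a b → χP a b + χQ a b) , ∘₂-computable₂ +-computable₂ χP? χQ? ,
  λ a b → (λ (p , q) → cong₂ _+_ (proj₁ (P⇔ a b) p) (proj₁ (Q⇔ a b) q)) ,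
          (λ s≡0 → proj₂ (P⇔ a b) (m+n≡0⇒m≡0 _ s≡0) , proj₂ (Q⇔ a b) (m+n≡0⇒n≡0 _ s≡0))

¬-computableRel : ComputableRel P → ComputableRel (λ a b → ¬ P a b)
¬-computableRel (χ , χ? , P⇔) =
  (λ a b → 1 ∸ χ a b) , ∘-computable₂ 1∸-computable χ? ,
  λ a b → (λ ¬p → m≤n⇒m∸n≡0 (n≢0⇒n>0 (¬p ∘ proj₂ (P⇔ a b)))) ,
          (λ e p → n>0⇒n≢0 (m∸n≡0⇒m≤n e) (proj₁ (P⇔ a b) p))

→-computableRel : ComputableRel P → ComputableRel Q → ComputableRel (λ a b → P a b → Q a b)
→-computableRel {P} {Q} (χP , χP? , P⇔) (χQ , χQ? , Q⇔) =
  (λ a b → (1 ∸ χP a b) * χQ a b) ,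
  ∘₂-computable₂ *-computable₂ (∘-computable₂ 1∸-computable χP?) χQ? ,
  λ a b → to a b , from a b
  where
  to : ∀ a b → (P a b → Q a b) → (1 ∸ χP a b) * χQ a b ≡ 0
  to a b p⇒q with χP a b ≟ 0
  ... | yes χP≡0 = trans (cong ((1 ∸ χP a b) *_) (proj₁ (Q⇔ a b) (p⇒q (proj₂ (P⇔ a b) χP≡0))))
                         (*-zeroʳ (1 ∸ χP a b))
  ... | no  χP≢0 = cong (_* χQ a b) (m≤n⇒m∸n≡0 (n≢0⇒n>0 χP≢0))
  from : ∀ a b → (1 ∸ χP a b) * χQ a b ≡ 0 → P a b → Q a b
  from a b prod≡0 p with m*n≡0⇒m≡0∨n≡0 (1 ∸ χP a b) prod≡0
  ... | inj₁ 1∸χP≡0 = ⊥-elim (n>0⇒n≢0 (m∸n≡0⇒m≤n 1∸χP≡0) (proj₁ (P⇔ a b) p))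
  ... | inj₂ χQ≡0  = proj₂ (Q⇔ a b) χQ≡0

search-computable : ∀ {R : ℕ → ℕ → Set} → ComputableRel R → (∀ x → ∃ λ n → R n x) →
                    Σ (ℕ → ℕ) λ μ → Computable μ × (∀ x → R (μ x) x)
search-computable (χ , χ? , R⇔) R-total =
  μ , μ-computable χ? (proj₂ ∘ least) , λ x → proj₂ (R⇔ (μ x) x) (proj₁ (proj₂ (least x)))
  where
  least : ∀ x → ∃ (IsLeastZero (λ n → χ n x))
  least x = least-zero (λ n → χ n x) (proj₁ (R⇔ _ x) (proj₂ (R-total x)))
  μ : ℕ → ℕ
  μ = proj₁ ∘ least

injective-unbounded : Injective _≡_ _≡_ g → ∀ N → ∃ λ k → N ≤ g k
injective-unbounded {g} g-injective N with any? (λ (k : Fin (suc N)) → N ≤? g (toℕ k))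
... | yes (k , N≤gk) = toℕ k , N≤gk
... | no  ∄k with i , j , i<j , Fi≡Fj ← pigeonhole (n<1+n N) (λ k → fromℕ< (≰⇒> (∄k ∘ (k ,_)))) =
  ⊥-elim (<-irrefl (g-injective (fromℕ<-injective _ _ _ _ Fi≡Fj)) i<j)

finiteToOne-avoids : FiniteToOne f → Injective _≡_ _≡_ g → ∀ y → ∃ λ k → f (g k) ≢ y
finiteToOne-avoids {f} {g} f-fin g-injective y
  with N , f⁻¹y<N ← f-fin y
  with k , N≤gk ← injective-unbounded g-injective N =
  k , λ fgk≡y → <⇒≱ (f⁻¹y<N (g k) fgk≡y) N≤gk

pair-∈-D : ∀ {x i} → U x ⊎ i ≡ 0 → D U (pair x i)
pair-∈-D h = _ , _ , refl , h

D-fibre-∉ : ∀ {x n} → ¬ U x → D U n → π₁ n ≡ x → n ≡ pair x 0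
D-fibre-∉ {U} x∉U (x′ , i , refl , h) π₁≡x with h
... | inj₁ x′∈U = ⊥-elim (x∉U (subst U x′≡x x′∈U))
  where x′≡x = trans (sym (π₁-pair x′ i)) π₁≡x
... | inj₂ refl = cong (λ z → pair z 0) (trans (sym (π₁-pair x′ 0)) π₁≡x)

fibre-enumeration : ∀ {σ x} → (∀ y → D U y → ∃ λ n → σ n ≡ y) → U x →
                    Σ (ℕ → ℕ) λ e → Injective _≡_ _≡_ e × (∀ i → σ (e i) ≡ pair x i)
fibre-enumeration {σ = σ} {x} σ-onto x∈U = e , e-injective , σ∘e
  where
  e : ℕ → ℕ
  e i = proj₁ (σ-onto (pair x i) (pair-∈-D (inj₁ x∈U)))
  σ∘e : ∀ i → σ (e i) ≡ pair x i
  σ∘e i = proj₂ (σ-onto (pair x i) (pair-∈-D (inj₁ x∈U)))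
  e-injective : Injective _≡_ _≡_ e
  e-injective {i} {j} ei≡ej = pair-injectiveʳ x (trans (sym (σ∘e i)) (trans (cong σ ei≡ej) (σ∘e j)))

module _ {S T : SetN} {σT σS f : ℕ → ℕ} where

  Escapes : ℕ → ℕ → Set
  Escapes n x = π₁ (σT n) ≡ x × ((T ∖ S) x → π₁ (σS (f n)) ≢ x)

  escapes-computable : ComputableSet T → ComputableSet S → Computable σT → Computable σS →
                       Computable f → ComputableRel Escapes
  escapes-computable T? S? σT? σS? f? =
    ×-computableRel (lies-over σT?)
      (→-computableRel (×-computableRel (right-computableRel T?)
                                        (¬-computableRel (right-computableRel S?)))
                       (¬-computableRel (lies-over (∘-computable σS? f?))))
    where
    lies-over : Computable g → ComputableRel (λ n x → π₁ (g n) ≡ x)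
    lies-over g? = ≡-computableRel (left-computable₂ (∘-computable π₁-computable g?))
                                   (right-computable₂ id-computable)

  escapes-total : (∀ x → Dec (T x)) → CompBijOnto σT (D T) → CompBijOnto σS (D S) →
                  FiniteToOne f → ∀ x → ∃ λ n → Escapes n x
  escapes-total T-dec (_ , _ , _ , σT-onto) (_ , σS-into , σS-injective , σS-onto) f-fin x
    with T-dec x
  ... | no x∉T
    with n₀ , σT-n₀ ← σT-onto (pair x 0) (pair-∈-D {x = x} (inj₂ refl)) =
    n₀ , trans (cong π₁ σT-n₀) (π₁-pair x 0) , λ (x∈T , _) → ⊥-elim (x∉T x∈T)
  ... | yes x∈T
    with m₀ , σS-m₀ ← σS-onto (pair x 0) (pair-∈-D {x = x} (inj₂ refl))
    with e , e-injective , σT∘e ← fibre-enumeration σT-onto x∈T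
    with k , fek≢m₀ ← finiteToOne-avoids f-fin e-injective m₀ =
    e k , trans (cong π₁ (σT∘e k)) (π₁-pair x k) ,
    λ (_ , x∉S) π₁≡x →
      fek≢m₀ (σS-injective _ _ (trans (D-fibre-∉ x∉S (σS-into _) π₁≡x) (sym σS-m₀)))

≤fin⇒displacing-self-reduction :
  ∀ {A S T σT σS} → ComputableSet T → ComputableSet S →
  CompBijOnto σT (D T) → CompBijOnto σS (D S) → B A σT ≤fin B A σS →
  Σ (ℕ → ℕ) λ h → Computable h × (∀ x → A x ⇔ A (h x)) × (∀ {x} → (T ∖ S) x → h x ≢ x)
≤fin⇒displacing-self-reduction {A} {σS = σS} T? S? bijT@(σT? , _) bijS@(σS? , _)
                               (f , f? , f-fin , f-reduces) =
  let μ , μ? , μ-escapes = search-computable (escapes-computable T? S? σT? σS? f?)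
                                             (escapes-total (computableSet-dec T?) bijT bijS f-fin)
  in π₁ ∘ σS ∘ f ∘ μ ,
     ∘-computable π₁-computable (∘-computable σS? (∘-computable f? μ?)) ,
     (λ x → subst (λ z → A z ⇔ A (π₁ (σS (f (μ x))))) (proj₁ (μ-escapes x)) (f-reduces (μ x))) ,
     λ {x} → proj₂ (μ-escapes x)

theorem5p3 : (A S T : SetN) → MRigid A → ComputableSet S → ComputableSet T →
    Infinite (T ∖ S) →
    (σT σS : ℕ → ℕ) → CompBijOnto σT (D T) → CompBijOnto σS (D S) →
    ¬ (B A σT ≤fin B A σS)
theorem5p3 A S T rigid S? T? T∖S-infinite σT σS bijT bijS reduction =
  let h , h? , h-reduces , h-displaces = ≤fin⇒displacing-self-reduction T? S? bijT bijS reduction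
      N , h-fixes = rigid h h? h-reduces
      x , N≤x , x∈T∖S = T∖S-infinite N
  in h-displaces x∈T∖S (h-fixes x N≤x)
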